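{- Let $E$ be a (live) event structure. Then $\mathcal{D}(E)=\langle\mathrm{Conf}(E),\subseteq\rangle$ is a weak prime domain. Moreover, for every event structure morphism $f:E_1\to E_2$, the map $\mathcal{D}(f):\mathcal{D}(E_1)\to\mathcal{D}(E_2)$, $C\mapsto\{f(e)\mid e\in C,\ f(e)\text{ defined}\}$, is a weak prime domain morphism.
   Context: Event structures: $\langle E,\vdash,\#\rangle$, $\vdash\subseteq\mathcal{P}_{fin}(E)\times E$ with $X\vdash e$, $X\subseteq Y\Rightarrow Y\vdash e$; $\#\subseteq E\times E$. Consistent: no two elements in conflict. Configuration: consistent $C$ in which each $e\in C$ has $e_1,\dots,e_n=e$ in $C$ with $\{e_1,\dots,e_{k-1}\}\vdash e_k$. Live: events not in a common configuration are in conflict; $\neg(e\#e)$. Morphism $f:E_1\to E_2$: partial function such that for all configurations $C_1$ and $e_1,e_1'$ with $f$ defined: $f(e_1)\#f(e_1')\Rightarrow e_1\#e_1'$; $f(e_1)=f(e_1')$, $e_1\neq e_1'\Rightarrow e_1\#e_1'$; $C_1\vdash_1 e_1\Rightarrow f(C_1)\vdash_2 f(e_1)$. Domains: $x\preceq y$ iff $x\sqsubseteq y$ and nothing lies strictly between; consistent = has an upper bound; pairwise consistent = every two elements have an upper bound. A domain is a partial order where pairwise consistent sets have joins, every element is the join of the compacts below it (compact: below an element of every directed set whose join it is below), and each compact has finitely many elements below. Irreducible: compact $i$ such that $i=\bigsqcup X$ for a pairwise consistent set $X$ of compacts implies $i\in X$. $i\leftrightarrow i'$ iff for all sets $X$ of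 irreducibles with $X\cup\{i\},X\cup\{i'\}$ downward closed and consistent $\bigsqcup(X\cup\{i\})=\bigsqcup(X\cup\{i'\})$, and for some such $X$, $\bigsqcup X\neq\bigsqcup(X\cup\{i\})$. Weak prime: irreducible $i$ such that $i\sqsubseteq\bigsqcup X$, $X$ consistent, implies some irreducible $i'\leftrightarrow i$ is below some element of $X$. Weak prime domain: every element is the join of the weak primes below it. Weak prime domain morphism: total $f$ with (1) $d\preceq d'\Rightarrow f(d)\preceq f(d')$; (2) $f(\bigsqcup X)=\bigsqcup f(X)$ for consistent $X$; (3) $f(d\sqcap d')=f(d)\sqcap f(d')$ whenever $d,d'$ consistent and $d\sqcap d'\preceq d$. -}

module Defs where

open import Level using (Level; _⊔_; 0ℓ) renaming (suc to lsuc)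
open import Data.Product using (Σ; ∃; _×_; _,_; proj₁; proj₂)
open import Data.Sum using (_⊎_)
open import Data.Empty using (⊥)
open import Data.Maybe using (Maybe; just)
open import Data.List using (List; []; _∷_; _∷ʳ_; length; take; lookup)
open import Data.List.Relation.Unary.All using (All)
open import Data.List.Relation.Unary.Any using (Any)
open import Data.List.Membership.Propositional using (_∈_)
open import Data.Fin using (Fin; toℕ)
open import Relation.Nullary using (¬_)
open import Relation.Unary using (Pred)
open import Relation.Binary.PropositionalEquality using (_≡_)
open import Relation.Binary.Bundles using (Poset)
open import Relation.Binary.Structures using (IsPartialOrder; IsPreorder; IsEquivalence)

-- Event structures  ⟨E, ⊢, #⟩
-- Finite subsets of E are represented by lists (read as the set of their
-- members); the saturation axiom (X ⊆ Y ⇒ Y ⊢ e) is stated w.r.t.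
-- membership, so ⊢ only depends on the underlying finite set.

record EventStructure : Set₁ where
  field
    Ev   : Set
    _⊢_  : List Ev → Ev → Set
    _#_  : Ev → Ev → Set
    ⊢-mono : ∀ {X Y : List Ev} {e : Ev} →
             (∀ {x} → x ∈ X → x ∈ Y) → X ⊢ e → Y ⊢ e

module ES (ℰ : EventStructure) where
  open EventStructure ℰ public

  ConsistentSet : Pred Ev 0ℓ → Set
  ConsistentSet C = ∀ e e' → C e → C e' → ¬ (e # e')

  SecuredIn : Pred Ev 0ℓ → Ev → Set
  SecuredIn C e =
    Σ (List Ev) λ xs →
      All C (xs ∷ʳ e) ×
      (∀ (k : Fin (length (xs ∷ʳ e))) →
         take (toℕ k) (xs ∷ʳ e) ⊢ lookup (xs ∷ʳ e) k)

  IsConfig : Pred Ev 0ℓ → Set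
  IsConfig C = ConsistentSet C × (∀ e → C e → SecuredIn C e)

  Live : Set₁
  Live = (∀ e e' → ¬ (Σ (Pred Ev 0ℓ) λ C → IsConfig C × C e × C e') → e # e')
       × (∀ e → ¬ (e # e))

  _⊢*_ : Pred Ev 0ℓ → Ev → Set
  C ⊢* e = Σ (List Ev) λ X → All C X × X ⊢ e

  Conf : Set₁
  Conf = Σ (Pred Ev 0ℓ) IsConfig

module _ (ℰ₁ ℰ₂ : EventStructure) where
  private
    module E₁ = ES ℰ₁
    module E₂ = ES ℰ₂

  imageSet : (E₁.Ev → Maybe E₂.Ev) → Pred E₁.Ev 0ℓ → Pred E₂.Ev 0ℓ
  imageSet f C e₂ = Σ E₁.Ev λ e₁ → C e₁ × f e₁ ≡ just e₂

  IsESMorphism : (E₁.Ev → Maybe E₂.Ev) → Set₁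
  IsESMorphism f =
    ∀ (C₁ : Pred E₁.Ev 0ℓ) → E₁.IsConfig C₁ →
    ∀ (e₁ e₁' : E₁.Ev) (a a' : E₂.Ev) → f e₁ ≡ just a → f e₁' ≡ just a' →
      (a E₂.# a' → e₁ E₁.# e₁')
    × (a ≡ a' → ¬ (e₁ ≡ e₁') → e₁ E₁.# e₁')
    × (C₁ E₁.⊢* e₁ → imageSet f C₁ E₂.⊢* a)

module _ (ℰ : EventStructure) where
  open ES ℰ

  _⊆c_ : Conf → Conf → Set
  (C , _) ⊆c (D , _) = ∀ e → C e → D e

  _≈c_ : Conf → Conf → Set
  x ≈c y = x ⊆c y × y ⊆c x

  𝒟 : Poset (lsuc 0ℓ) 0ℓ 0ℓ
  𝒟 = record
    { Carrier = Conf
    ; _≈_ = _≈c_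
    ; _≤_ = _⊆c_
    ; isPartialOrder = record
      { isPreorder = record
        { isEquivalence = record
          { refl = (λ e z → z) , (λ e z → z)
          ; sym = λ (p , q) → q , p
          ; trans = λ (p , q) (r , s) → (λ e z → r e (p e z)) , (λ e z → q e (s e z))
          }
        ; reflexive = proj₁
        ; trans = λ p q e z → q e (p e z)
        }
      ; antisym = _,_
      }
    }

-- Domain-theoretic notions on a poset (carrier with setoid equality ≈).
-- Sets of elements are predicates; membership of an element in a set is
-- read up to ≈ where the paper writes "i ∈ X".

module DomainTheory {c ℓ₁ ℓ₂ : Level} (P : Poset c ℓ₁ ℓ₂) where
  open Poset P renaming (_≤_ to _⊑_)

  ℓS : Level
  ℓS = c ⊔ ℓ₁ ⊔ ℓ₂

  Sub : Set (lsuc ℓS)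
  Sub = Pred Carrier ℓS

  private
    variable
      a b : Level

  _⊏_ : Carrier → Carrier → Set (ℓ₁ ⊔ ℓ₂)
  x ⊏ y = x ⊑ y × ¬ (x ≈ y)

  _≼_ : Carrier → Carrier → Set _
  x ≼ y = x ⊑ y × ¬ (Σ Carrier λ z → x ⊏ z × z ⊏ y)

  UpperBound : Pred Carrier a → Carrier → Set _
  UpperBound X u = ∀ x → X x → x ⊑ u

  Consistent : Pred Carrier a → Set _
  Consistent X = Σ Carrier λ u → UpperBound X u

  PairwiseConsistent : Pred Carrier a → Set _
  PairwiseConsistent X = ∀ x y → X x → X y → Σ Carrier λ u → x ⊑ u × y ⊑ u

  IsJoin : Pred Carrier a → Carrier → Set _
  IsJoin X j = UpperBound X j × (∀ u → UpperBound X u → j ⊑ u)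

  IsMeet : Carrier → Carrier → Carrier → Set _
  IsMeet x y m = (m ⊑ x × m ⊑ y) × (∀ l → l ⊑ x → l ⊑ y → l ⊑ m)

  Directed : Pred Carrier a → Set _
  Directed X = (Σ Carrier X) ×
               (∀ x y → X x → X y → Σ Carrier λ z → X z × x ⊑ z × y ⊑ z)

  Compact : Carrier → Set _
  Compact k = ∀ (X : Sub) → Directed X → ∀ j → IsJoin X j → k ⊑ j →
              Σ Carrier λ x → X x × k ⊑ x

  FiniteSub : Pred Carrier a → Set _
  FiniteSub S = Σ (List Carrier) λ L → ∀ d → S d → Any (d ≈_) L

  singleton : Carrier → Pred Carrier ℓ₁
  singleton i x = x ≈ i

  _∪_ : Pred Carrier a → Pred Carrier b → Pred Carrier (a ⊔ b)
  (X ∪ Y) x = X x ⊎ Y x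

  IsDomain : Set _
  IsDomain =
      (∀ (X : Sub) → PairwiseConsistent X → Σ Carrier λ j → IsJoin X j)
    × (∀ d → IsJoin (λ k → Compact k × k ⊑ d) d)
    × (∀ k → Compact k → FiniteSub (λ d → d ⊑ k))

  Irreducible : Carrier → Set _
  Irreducible i = Compact i ×
    (∀ (X : Sub) → (∀ x → X x → Compact x) → PairwiseConsistent X →
       IsJoin X i → Σ Carrier λ x → X x × i ≈ x)

  DownClosedIrr : Pred Carrier a → Set _
  DownClosedIrr S = ∀ x y → S y → Irreducible x → x ⊑ y → S x

  Admissible : Carrier → Carrier → Sub → Set _
  Admissible i i' X =
    (∀ x → X x → Irreducible x) ×
    DownClosedIrr (X ∪ singleton i) × Consistent (X ∪ singleton i) ×
    DownClosedIrr (X ∪ singleton i') × Consistent (X ∪ singleton i')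

  _↔_ : Carrier → Carrier → Set _
  i ↔ i' =
      (∀ (X : Sub) → Admissible i i' X →
         ∀ j j' → IsJoin (X ∪ singleton i) j → IsJoin (X ∪ singleton i') j' → j ≈ j')
    × (Σ Sub λ X → Admissible i i' X ×
         Σ Carrier λ j → Σ Carrier λ j' →
           IsJoin X j × IsJoin (X ∪ singleton i) j' × ¬ (j ≈ j'))

  WeakPrime : Carrier → Set _
  WeakPrime i = Irreducible i ×
    (∀ (X : Sub) → Consistent X → ∀ j → IsJoin X j → i ⊑ j →
       Σ Carrier λ i' → Irreducible i' × i' ↔ i × Σ Carrier λ x → X x × i' ⊑ x)

  IsWeakPrimeDomain : Set _
  IsWeakPrimeDomain =
    IsDomain × (∀ d → IsJoin (λ p → WeakPrime p × p ⊑ d) d)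

module _ {c ℓ₁ ℓ₂ : Level} (P Q : Poset c ℓ₁ ℓ₂) where
  private
    module P = Poset P
    module Q = Poset Q
    module DP = DomainTheory P
    module DQ = DomainTheory Q

  imageSub : (P.Carrier → Q.Carrier) → DP.Sub → DQ.Sub
  imageSub f X y = Σ P.Carrier λ x → X x × y Q.≈ f x

  IsWPDMorphism : (P.Carrier → Q.Carrier) → Set _
  IsWPDMorphism f =
      (∀ {x y} → x P.≈ y → f x Q.≈ f y)
    × (∀ d d' → d DP.≼ d' → f d DQ.≼ f d')
    × (∀ (X : DP.Sub) → DP.Consistent X → ∀ j → DP.IsJoin X j →
         DQ.IsJoin (imageSub f X) (f j))
    × (∀ d d' → (Σ P.Carrier λ u → d P.≤ u × d' P.≤ u) →
         ∀ m → DP.IsMeet d d' m → m DP.≼ d → DQ.IsMeet (f d) (f d') (f m))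

module _ (ℰ₁ ℰ₂ : EventStructure) where
  private
    module E₁ = ES ℰ₁
    module E₂ = ES ℰ₂

  PreservesConfigs : (E₁.Ev → Maybe E₂.Ev) → Set₁
  PreservesConfigs f = ∀ C → E₁.IsConfig C → E₂.IsConfig (imageSet ℰ₁ ℰ₂ f C)

  𝒟map : (f : E₁.Ev → Maybe E₂.Ev) → PreservesConfigs f → E₁.Conf → E₂.Conf
  𝒟map f p (C , c) = imageSet ℰ₁ ℰ₂ f C , p C c

-- Configurations are closed under unions of pairwise consistent families, so joins are unions,
-- and the compact configurations are the finite ones.  Below any configuration containing an
-- event e there is a least configuration [e] containing e.  It is a weak prime: two such
-- histories of the same event are ↔-related, because adding either of them to a down-closed set
-- of irreducibles has the same effect on the join, namely adding e.  Every configuration is the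
-- union of the [e] below it.  For a morphism f, images of securing sequences are securing
-- sequences, so 𝒟(f) is defined, and it preserves joins since these are unions.  A covering
-- d ≼ d′ adds exactly one event and f is injective on configurations; together these give the
-- preservation of ≼ and of the meets in (3).
module Submission where

open import Defs
open import Level using (Lift; lift; lower; 0ℓ)
open import Data.Product using (Σ; _×_; _,_; proj₁; proj₂)
open import Data.Sum using (_⊎_; inj₁; inj₂)
open import Data.Empty using (⊥; ⊥-elim)
open import Data.Unit using (⊤; tt)
open import Data.Bool using (true; false)
open import Data.Maybe using (Maybe; just; nothing)
open import Data.Maybe.Properties using (just-injective)
open import Data.Nat using (zero; suc; _≤_)
open import Data.Nat.Properties using (≤-refl; ≤-trans; ≤-pred)
open import Data.List using (List; []; _∷_; _∷ʳ_; _++_; [_]; length; take; lookup; map; filter; mapMaybe)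
open import Data.List.Properties using (++-assoc; ++-identityʳ; filter-notAll; mapMaybe-++)
open import Data.List.Relation.Unary.All as All using (All; []; _∷_)
import Data.List.Relation.Unary.All.Properties as All
open import Data.List.Relation.Unary.Any using (Any; here; there)
open import Data.List.Relation.Unary.First as First using (FirstView)
open import Data.List.Relation.Unary.First.Properties using (¬All⇒First; toView)
open import Data.List.Membership.Propositional using (_∈_; lose)
open import Data.List.Membership.Propositional.Properties
  using (∈-++⁺ˡ; ∈-++⁺ʳ; ∈-++⁻; ∈-∃++; ∈-map⁺; ∈-filter⁺; ∈-filter⁻)
open import Data.Fin using (Fin; toℕ; zero; suc)
open import Function using (id)
open import Relation.Nullary using (¬_; does; yes; no)
open import Relation.Nullary.Decidable using (True; toWitness; fromWitness; decidable-stable)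
open import Relation.Unary using (Pred; Decidable; ∁)
open import Relation.Binary.PropositionalEquality using (_≡_; refl; sym; trans; cong; subst)
open import Relation.Binary.Bundles using (Poset)
open import Axiom.ExcludedMiddle using (ExcludedMiddle)

sublists : ∀ {a} {A : Set a} → List A → List (List A)
sublists []       = [ [] ]
sublists (x ∷ xs) = map (x ∷_) (sublists xs) ++ sublists xs

filter∈sublists : ∀ {a p} {A : Set a} {P : Pred A p} (P? : Decidable P) xs →
                  filter P? xs ∈ sublists xs
filter∈sublists P? []       = here refl
filter∈sublists P? (x ∷ xs) with does (P? x)
... | true  = ∈-++⁺ˡ (∈-map⁺ (x ∷_) (filter∈sublists P? xs))
... | false = ∈-++⁺ʳ _ (filter∈sublists P? xs)

∈-mapMaybe⁺ : ∀ {a b} {A : Set a} {B : Set b} (f : A → Maybe B) {x y} xs →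
              x ∈ xs → f x ≡ just y → y ∈ mapMaybe f xs
∈-mapMaybe⁺ f (x ∷ xs) (here refl) fx rewrite fx = here refl
∈-mapMaybe⁺ f (x′ ∷ xs) (there x∈) fx with f x′
... | just _  = there (∈-mapMaybe⁺ f xs x∈ fx)
... | nothing = ∈-mapMaybe⁺ f xs x∈ fx

∈-mapMaybe⁻ : ∀ {a b} {A : Set a} {B : Set b} (f : A → Maybe B) {y} xs →
              y ∈ mapMaybe f xs → Σ A λ x → x ∈ xs × f x ≡ just y
∈-mapMaybe⁻ f (x ∷ xs) y∈ with f x in fx
∈-mapMaybe⁻ f (x ∷ xs) (here refl) | just _ = x , here refl , fx
∈-mapMaybe⁻ f (x ∷ xs) (there y∈)  | just _ =
  let (x′ , x′∈ , fx′) = ∈-mapMaybe⁻ f xs y∈ in x′ , there x′∈ , fx′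
∈-mapMaybe⁻ f (x ∷ xs) y∈          | nothing =
  let (x′ , x′∈ , fx′) = ∈-mapMaybe⁻ f xs y∈ in x′ , there x′∈ , fx′

module Classical (em : ∀ {ℓ} → ExcludedMiddle ℓ) where

  ¬⊆⇒∃ : ∀ {a p q} {A : Set a} {P : Pred A p} {Q : Pred A q} →
         ¬ (∀ x → P x → Q x) → Σ A λ x → P x × ¬ Q x
  ¬⊆⇒∃ {P = P} {Q} ¬⊆ = decidable-stable em λ ∄ →
    ¬⊆ λ x px → decidable-stable em λ ¬qx → ∄ (x , px , ¬qx)

  firstFailure : ∀ {a p} {A : Set a} (P : Pred A p) {xs x} → x ∈ xs → ¬ P x →
                 FirstView P (∁ P) xs
  firstFailure P x∈ ¬px = toView (¬All⇒First (λ _ → em) id λ all → ¬px (All.lookup all x∈))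

  -- A proposition of any level, resized to Set through its classical truth value.
  ⌊_⌋ : ∀ {ℓ} → Set ℓ → Set
  ⌊ A ⌋ = True (em {P = A})

  ⌊⌋-intro : ∀ {ℓ} {A : Set ℓ} → A → ⌊ A ⌋
  ⌊⌋-intro = fromWitness

  ⌊⌋-elim : ∀ {ℓ} {A : Set ℓ} → ⌊ A ⌋ → A
  ⌊⌋-elim = toWitness

module Securing (ℰ : EventStructure) where
  open ES ℰ

  infix 4 _⊆_
  _⊆_ : Pred Ev 0ℓ → Pred Ev 0ℓ → Set
  C ⊆ D = ∀ e → C e → D e

  setOf : List Ev → Pred Ev 0ℓ
  setOf L e = e ∈ L

  All⇒⊆ : ∀ {C L} → All C L → setOf L ⊆ C
  All⇒⊆ all _ e∈ = All.lookup all e∈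

  All-setOf : ∀ L → All (setOf L) L
  All-setOf L = All.tabulate id

  Secured : List Ev → List Ev → Set
  Secured pre []      = ⊤
  Secured pre (x ∷ L) = pre ⊢ x × Secured (pre ∷ʳ x) L

  Secured-++⁻ : ∀ pre A B → Secured pre (A ++ B) → Secured pre A × Secured (pre ++ A) B
  Secured-++⁻ pre []      B s rewrite ++-identityʳ pre = tt , s
  Secured-++⁻ pre (x ∷ A) B (px , s) with Secured-++⁻ (pre ∷ʳ x) A B s
  ... | sA , sB = (px , sA) , subst (λ p → Secured p B) (++-assoc pre [ x ] A) sB

  Secured-∷ʳ : ∀ pre {A x} → Secured pre A → (pre ++ A) ⊢ x → Secured pre (A ∷ʳ x)
  Secured-∷ʳ pre {[]}    _        px rewrite ++-identityʳ pre = px , tt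
  Secured-∷ʳ pre {y ∷ A} (py , s) px =
    py , Secured-∷ʳ (pre ∷ʳ y) s (subst (_⊢ _) (sym (++-assoc pre [ y ] A)) px)

  enabling⇒Secured : ∀ pre L →
                     (∀ (k : Fin (length L)) → (pre ++ take (toℕ k) L) ⊢ lookup L k) →
                     Secured pre L
  enabling⇒Secured pre []      _ = tt
  enabling⇒Secured pre (x ∷ L) h =
    subst (_⊢ x) (++-identityʳ pre) (h zero) ,
    enabling⇒Secured (pre ∷ʳ x) L λ k →
      subst (_⊢ lookup L k) (sym (++-assoc pre [ x ] (take (toℕ k) L))) (h (suc k))

  Secured⇒enabling : ∀ pre L → Secured pre L →
                     ∀ (k : Fin (length L)) → (pre ++ take (toℕ k) L) ⊢ lookup L k
  Secured⇒enabling pre (x ∷ L) (px , s) zero    = subst (_⊢ x) (sym (++-identityʳ pre)) px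
  Secured⇒enabling pre (x ∷ L) (px , s) (suc k) =
    subst (_⊢ lookup L k) (++-assoc pre [ x ] (take (toℕ k) L)) (Secured⇒enabling (pre ∷ʳ x) L s k)

  History : Pred Ev 0ℓ → Ev → Set
  History C e = Σ (List Ev) λ L → All C L × Secured [] L × e ∈ L

  SecuredIn⇒History : ∀ {C e} → SecuredIn C e → History C e
  SecuredIn⇒History {e = e} (xs , inC , h) =
    xs ∷ʳ e , inC , enabling⇒Secured [] (xs ∷ʳ e) h , ∈-++⁺ʳ xs (here refl)

  prefix⊆ : ∀ A x B → setOf (A ∷ʳ x) ⊆ setOf (A ++ x ∷ B)
  prefix⊆ A x B _ e∈ = subst (_ ∈_) (++-assoc A [ x ] B) (∈-++⁺ˡ e∈)

  Secured-prefix : ∀ A x B → Secured [] (A ++ x ∷ B) → Secured [] (A ∷ʳ x)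
  Secured-prefix A x B s =
    proj₁ (Secured-++⁻ [] (A ∷ʳ x) B (subst (Secured []) (sym (++-assoc A [ x ] B)) s))

  History⇒SecuredIn : ∀ {C e} → History C e → SecuredIn C e
  History⇒SecuredIn (L , inC , s , e∈) with ∈-∃++ e∈
  ... | A , B , refl =
    A , All.tabulate (λ x∈ → All.lookup inC (prefix⊆ A _ B _ x∈)) ,
    Secured⇒enabling [] _ (Secured-prefix A _ B s)

  SecuredIn-mono : ∀ {C D e} → C ⊆ D → SecuredIn C e → SecuredIn D e
  SecuredIn-mono C⊆D (xs , inC , h) = xs , All.map (C⊆D _) inC , h

  ConsistentSet-anti : ∀ {C D} → C ⊆ D → ConsistentSet D → ConsistentSet C
  ConsistentSet-anti C⊆D cons e e′ ce ce′ = cons e e′ (C⊆D e ce) (C⊆D e′ ce′)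

  IsConfig-resp : ∀ {C D} → C ⊆ D → D ⊆ C → IsConfig C → IsConfig D
  IsConfig-resp C⊆D D⊆C (cons , sec) =
    ConsistentSet-anti D⊆C cons , λ e de → SecuredIn-mono C⊆D (sec e (D⊆C e de))

  IsConfig-setOf : ∀ {C L} → ConsistentSet C → All C L → Secured [] L → IsConfig (setOf L)
  IsConfig-setOf {L = L} cons inC s =
    ConsistentSet-anti (All⇒⊆ inC) cons ,
    λ e e∈ → History⇒SecuredIn (L , All-setOf L , s , e∈)

  prefix-isConfig : ∀ {C} → ConsistentSet C → ∀ A x B → All C (A ++ x ∷ B) →
                    Secured [] (A ++ x ∷ B) → IsConfig (setOf (A ∷ʳ x))
  prefix-isConfig cons A x B inC s =
    IsConfig-setOf cons (All.tabulate λ y∈ → All.lookup inC (prefix⊆ A x B _ y∈))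
                        (Secured-prefix A x B s)

  IsConfig-∪ : ∀ {C D W} → IsConfig C → IsConfig D → C ⊆ W → D ⊆ W → ConsistentSet W →
               IsConfig (λ e → C e ⊎ D e)
  IsConfig-∪ (_ , secC) (_ , secD) C⊆W D⊆W cons =
    ConsistentSet-anti (λ { e (inj₁ ce) → C⊆W e ce ; e (inj₂ de) → D⊆W e de }) cons ,
    λ { e (inj₁ ce) → SecuredIn-mono (λ _ → inj₁) (secC e ce)
      ; e (inj₂ de) → SecuredIn-mono (λ _ → inj₂) (secD e de) }

  history : ((C , _) : Conf) → ∀ {e} → C e → History C e
  history (C , _ , sec) ce = SecuredIn⇒History (sec _ ce)

  ∅ᶜ : Conf
  ∅ᶜ = (λ _ → ⊥) , (λ _ _ ()) , (λ _ ())

module ConfigurationDomain (em : ∀ {ℓ} → ExcludedMiddle ℓ) (ℰ : EventStructure) where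
  open ES ℰ
  open Securing ℰ
  open Classical em
  open DomainTheory (𝒟 ℰ)
  open Poset (𝒟 ℰ) using (_≈_; module Eq)

  infix 4 _∈ᶜ_ _⊑_
  _∈ᶜ_ : Ev → Conf → Set
  e ∈ᶜ x = proj₁ x e

  _⊑_ : Conf → Conf → Set
  _⊑_ = _⊆c_ ℰ

  ⊑-refl : ∀ {x} → x ⊑ x
  ⊑-refl _ xe = xe

  ⊑-trans : ∀ {x y z} → x ⊑ y → y ⊑ z → x ⊑ z
  ⊑-trans x⊑y y⊑z e xe = y⊑z e (x⊑y e xe)

  unionBelow : ∀ x y w → x ⊑ w → y ⊑ w → Conf
  unionBelow x y w x⊑w y⊑w =
    (λ e → e ∈ᶜ x ⊎ e ∈ᶜ y) , IsConfig-∪ (proj₂ x) (proj₂ y) x⊑w y⊑w (proj₁ (proj₂ w))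

  finiteSubconfig : (C : Conf) → ∀ {e} → e ∈ᶜ C →
                    Σ (List Ev) λ L → Σ (IsConfig (setOf L)) λ c → (setOf L , c) ⊑ C × e ∈ L
  finiteSubconfig C ce with history C ce
  ... | L , inC , s , e∈ = L , IsConfig-setOf (proj₁ (proj₂ C)) inC s , All⇒⊆ inC , e∈

  ⋃ : ∀ {a} → Pred Conf a → Pred Ev 0ℓ
  ⋃ X e = ⌊ Σ Conf (λ x → X x × e ∈ᶜ x) ⌋

  ⋃-isConfig : ∀ {a} (X : Pred Conf a) → PairwiseConsistent X → IsConfig (⋃ X)
  ⋃-isConfig X pw = cons , sec
    where
      cons : ConsistentSet (⋃ X)
      cons e e′ ue ue′ with ⌊⌋-elim ue | ⌊⌋-elim ue′
      ... | x , Xx , xe | y , Xy , ye with pw x y Xx Xy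
      ... | (_ , w-cons , _) , x⊑w , y⊑w = w-cons e e′ (x⊑w e xe) (y⊑w e′ ye)
      sec : ∀ e → ⋃ X e → SecuredIn (⋃ X) e
      sec e ue with ⌊⌋-elim ue
      ... | x , Xx , xe = SecuredIn-mono (λ _ xz → ⌊⌋-intro (x , Xx , xz)) (proj₂ (proj₂ x) e xe)

  ⋃ᶜ : ∀ {a} (X : Pred Conf a) → PairwiseConsistent X → Conf
  ⋃ᶜ X pw = ⋃ X , ⋃-isConfig X pw

  ⋃-isJoin : ∀ {a} (X : Pred Conf a) (pw : PairwiseConsistent X) → IsJoin X (⋃ᶜ X pw)
  ⋃-isJoin X pw = (λ x Xx e xe → ⌊⌋-intro (x , Xx , xe)) ,
                  λ u ub e ue → let (x , Xx , xe) = ⌊⌋-elim ue in ub x Xx e xe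

  ∈join⇒∈member : ∀ {a} (X : Pred Conf a) → PairwiseConsistent X → ∀ j → IsJoin X j →
                  ∀ {e} → e ∈ᶜ j → Σ Conf λ x → X x × e ∈ᶜ x
  ∈join⇒∈member X pw _ (_ , least) je =
    ⌊⌋-elim (least (⋃ᶜ X pw) (proj₁ (⋃-isJoin X pw)) _ je)

  consistent⇒pairwise : ∀ {a} {X : Pred Conf a} → Consistent X → PairwiseConsistent X
  consistent⇒pairwise (u , ub) x y Xx Xy = u , ub x Xx , ub y Xy

  directed⇒pairwise : ∀ {a} {X : Pred Conf a} → Directed X → PairwiseConsistent X
  directed⇒pairwise (_ , updir) x y Xx Xy =
    let (z , _ , x⊑z , y⊑z) = updir x y Xx Xy in z , x⊑z , y⊑z

  Finite : Conf → Set
  Finite k = Σ (List Ev) λ P → proj₁ k ⊆ setOf P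

  finite⇒compact : ∀ k → Finite k → Compact k
  finite⇒compact k (P , k⊆P) X dir@((x₀ , Xx₀) , updir) j jJ k⊑j =
    let (x , Xx , covers) = cover P in x , Xx , λ e ke → covers (k⊆P e ke) ke
    where
      cover : ∀ Q → Σ Conf λ x → X x × (∀ {e} → e ∈ Q → e ∈ᶜ k → e ∈ᶜ x)
      cover []      = x₀ , Xx₀ , λ ()
      cover (h ∷ Q) with cover Q | em {P = h ∈ᶜ k}
      ... | x , Xx , covers | no h∉k =
        x , Xx , λ { (here refl) hk → ⊥-elim (h∉k hk) ; (there e∈) → covers e∈ }
      ... | x , Xx , covers | yes hk
        with ∈join⇒∈member X (directed⇒pairwise {X = X} dir) j jJ (k⊑j h hk)
      ... | y , Xy , hy with updir x y Xx Xy
      ... | z , Xz , x⊑z , y⊑z =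
        z , Xz , λ { (here refl) _ → y⊑z h hy ; (there e∈) ke → x⊑z _ (covers e∈ ke) }

  -- k is the directed join of its finite sub-configurations.
  compact⇒finite : ∀ k → Compact k → Finite k
  compact⇒finite k k-compact with k-compact FiniteBelow directed k isJoin (⊑-refl {k})
    where
      FiniteBelow : Sub
      FiniteBelow x = Lift ℓS (Finite x × x ⊑ k)
      directed : Directed FiniteBelow
      directed =
        (∅ᶜ , lift (([] , λ _ ()) , λ _ ())) ,
        λ { x y (lift ((P , x⊆P) , x⊑k)) (lift ((Q , y⊆Q) , y⊑k)) →
              unionBelow x y k x⊑k y⊑k ,
              lift ((P ++ Q , λ { e (inj₁ xe) → ∈-++⁺ˡ (x⊆P e xe)
                                ; e (inj₂ ye) → ∈-++⁺ʳ P (y⊆Q e ye) }) ,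
                    λ { e (inj₁ xe) → x⊑k e xe ; e (inj₂ ye) → y⊑k e ye }) ,
              (λ _ → inj₁) , (λ _ → inj₂) }
      isJoin : IsJoin FiniteBelow k
      isJoin = (λ _ x∈ → proj₂ (lower x∈)) ,
               λ u ub e ke → let (L , c , L⊑k , e∈) = finiteSubconfig k ke in
                 ub (setOf L , c) (lift ((L , λ _ → id) , L⊑k)) e e∈
  ... | x , lift ((P , x⊆P) , _) , k⊑x = P , λ e ke → x⊆P e (k⊑x e ke)

  configsAmong : List (List Ev) → List Conf
  configsAmong []       = []
  configsAmong (s ∷ ss) with em {P = IsConfig (setOf s)}
  ... | yes c = (setOf s , c) ∷ configsAmong ss
  ... | no _  = configsAmong ss

  configsAmong-complete : ∀ {s} ss → s ∈ ss → ∀ d → proj₁ d ⊆ setOf s → setOf s ⊆ proj₁ d →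
                          Any (d ≈_) (configsAmong ss)
  configsAmong-complete (t ∷ ss) s∈ d d⊆s s⊆d with em {P = IsConfig (setOf t)} | s∈
  ... | yes _ | here refl = here (d⊆s , s⊆d)
  ... | yes _ | there s∈′ = there (configsAmong-complete ss s∈′ d d⊆s s⊆d)
  ... | no ¬c | here refl = ⊥-elim (¬c (IsConfig-resp d⊆s s⊆d (proj₂ d)))
  ... | no _  | there s∈′ = configsAmong-complete ss s∈′ d d⊆s s⊆d

  -- Every configuration below k is determined by which events of P it contains.
  finitelyManyBelow : ∀ k → Finite k → FiniteSub (_⊑ k)
  finitelyManyBelow k (P , k⊆P) = configsAmong (sublists P) , λ d d⊑k →
    let d? : Decidable (_∈ᶜ d)
        d? _ = em
    in configsAmong-complete (sublists P) (filter∈sublists d? P) d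
         (λ e de → ∈-filter⁺ d? (k⊆P e (d⊑k e de)) de)
         (λ e e∈ → proj₂ (∈-filter⁻ d? {xs = P} e∈))

  isDomain : IsDomain
  isDomain =
    (λ X pw → ⋃ᶜ X pw , ⋃-isJoin X pw) ,
    (λ d → (λ _ → proj₂) , λ u ub e de → let (L , c , L⊑d , e∈) = finiteSubconfig d de in
       ub (setOf L , c) (finite⇒compact (setOf L , c) (L , λ _ → id) , L⊑d) e e∈) ,
    (λ k k-compact → finitelyManyBelow k (compact⇒finite k k-compact))

  -- The paper's prime history [e]: least among the configurations below it containing e.
  record IsMinimalFor (e : Ev) (i : Conf) : Set₁ where
    constructor _,_
    field
      contains : e ∈ᶜ i
      least    : ∀ q → q ⊑ i → e ∈ᶜ q → i ⊑ q
  open IsMinimalFor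

  minimalBelowList : ∀ {e} n L → length L ≤ n → (c : IsConfig (setOf L)) → e ∈ L →
                     Σ Conf λ i → IsMinimalFor e i × i ⊑ (setOf L , c)
  minimalBelowList zero    (_ ∷ _) () _ _
  minimalBelowList {e} (suc n) L |L|≤n c e∈
    with em {P = Σ Conf λ q → q ⊑ (setOf L , c) × e ∈ᶜ q × ¬ (setOf L , c) ⊑ q}
  ... | no ∄ = (setOf L , c) ,
               (e∈ , λ q q⊑L qe → decidable-stable em λ ¬L⊑q → ∄ (q , q⊑L , qe , ¬L⊑q)) ,
               ⊑-refl {setOf L , c}
  ... | yes (q , q⊑L , qe , ¬L⊑q) with ¬⊆⇒∃ ¬L⊑q
  ... | x , x∈L , x∉q
    with minimalBelowList n (filter q? L) shorter
           (IsConfig-resp (λ y qy → ∈-filter⁺ q? (q⊑L y qy) qy)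
                          (λ y y∈ → proj₂ (∈-filter⁻ q? {xs = L} y∈))
                          (proj₂ q))
           (∈-filter⁺ q? (q⊑L e qe) qe)
    where
      q? : Decidable (_∈ᶜ q)
      q? _ = em
      shorter : length (filter q? L) ≤ n
      shorter = ≤-pred (≤-trans (filter-notAll q? L (lose x∈L x∉q)) |L|≤n)
  ... | i , i-min , i⊑q∩L = i , i-min , λ y yi → proj₁ (∈-filter⁻ _ (i⊑q∩L y yi))

  minimalBelow : (C : Conf) → ∀ {e} → e ∈ᶜ C → Σ Conf λ i → IsMinimalFor e i × i ⊑ C
  minimalBelow C ce with finiteSubconfig C ce
  ... | L , c , L⊑C , e∈ with minimalBelowList (length L) L ≤-refl c e∈
  ... | i , i-min , i⊑L = i , i-min , ⊑-trans {i} {setOf L , c} {C} i⊑L L⊑C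

  minimal⇒finite : ∀ {e i} → IsMinimalFor e i → Finite i
  minimal⇒finite {i = i} (ie , least) with finiteSubconfig i ie
  ... | L , c , L⊑i , e∈ = L , least (setOf L , c) L⊑i e∈

  minimal⇒irreducible : ∀ {e i} → IsMinimalFor e i → Irreducible i
  minimal⇒irreducible {i = i} i-min@(ie , least) =
    finite⇒compact i (minimal⇒finite i-min) ,
    λ X _ pw jJ → let (x , Xx , xe) = ∈join⇒∈member X pw i jJ ie
                      x⊑i = proj₁ jJ x Xx
                  in x , Xx , least x x⊑i xe , x⊑i

  -- [e] ∖ {e} is again a configuration: cut a securing sequence of [e] before its first e.
  minimal-punctured : ∀ {e i} → IsMinimalFor e i →
                      Σ Conf λ a → ¬ e ∈ᶜ a × a ⊑ i × (∀ {y} → y ∈ᶜ i → ¬ y ≡ e → y ∈ᶜ a)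
  minimal-punctured {e} {i} (ie , least) with history i ie
  ... | L , inI , s , e∈ with firstFailure (λ y → ¬ y ≡ e) e∈ (λ e≢e → e≢e refl)
  ... | First._++_∷_ {A} {x} A≢e ¬x≢e B with decidable-stable em ¬x≢e
  ... | refl = a , (λ e∈A → All.lookup A≢e e∈A refl) , All⇒⊆ inA , rest
    where
      inA : All (_∈ᶜ i) A
      inA = All.++⁻ˡ A inI
      a : Conf
      a = setOf A , IsConfig-setOf (proj₁ (proj₂ i)) inA (proj₁ (Secured-++⁻ [] A (e ∷ B) s))
      A∷e : Conf
      A∷e = setOf (A ∷ʳ e) , prefix-isConfig (proj₁ (proj₂ i)) A e B inI s
      rest : ∀ {y} → y ∈ᶜ i → ¬ y ≡ e → y ∈ᶜ a
      rest yi y≢e with ∈-++⁻ A (least A∷e (λ y y∈ → All.lookup inI (prefix⊆ A e B y y∈))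
                                          (∈-++⁺ʳ A (here refl)) _ yi)
      ... | inj₁ y∈A        = y∈A
      ... | inj₂ (here y≡e) = ⊥-elim (y≢e y≡e)

  -- An event of [e] other than e has its prime history inside [e] ∖ {e}; down-closure puts it in X.
  minimal-join-⊑ : ∀ {e i i′} → IsMinimalFor e i → IsMinimalFor e i′ → (X : Sub) →
                   DownClosedIrr (X ∪ singleton i) → Consistent (X ∪ singleton i) →
                   ∀ j j′ → IsJoin (X ∪ singleton i) j → IsJoin (X ∪ singleton i′) j′ → j ⊑ j′
  minimal-join-⊑ {e} {i} {i′} i-min i′-min X down cons j j′ jJ j′J z zj
    with ∈join⇒∈member _ (consistent⇒pairwise {X = X ∪ singleton i} cons) j jJ zj
  ... | y , inj₁ Xy , zy = proj₁ j′J y (inj₁ Xy) z zy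
  ... | y , inj₂ (y⊑i , _) , zy with em {P = z ≡ e}
  ... | yes refl = proj₁ j′J i′ (inj₂ (Eq.refl {i′})) e (contains i′-min)
  ... | no z≢e with minimal-punctured i-min
  ... | a , e∉a , a⊑i , i∖e⊆a with minimalBelow a (i∖e⊆a (y⊑i z zy) z≢e)
  ... | r , r-min , r⊑a
    with down r i (inj₂ (Eq.refl {i})) (minimal⇒irreducible r-min) (⊑-trans {r} {a} {i} r⊑a a⊑i)
  ... | inj₁ Xr       = proj₁ j′J r (inj₁ Xr) z (contains r-min)
  ... | inj₂ (_ , i⊑r) = ⊥-elim (e∉a (r⊑a e (i⊑r e (contains i-min))))

  -- Separating set: the irreducibles below w avoiding e; adding [e] to it adds e to the join.
  minimal-↔ : ∀ {e i i′} w → IsMinimalFor e i → IsMinimalFor e i′ → i ⊑ w → i′ ⊑ w → i ↔ i′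
  minimal-↔ {e} {i} {i′} w i-min i′-min i⊑w i′⊑w =
    (λ X (_ , down , cons , down′ , cons′) j j′ jJ j′J →
       minimal-join-⊑ i-min i′-min X down cons j j′ jJ j′J ,
       minimal-join-⊑ i′-min i-min X down′ cons′ j′ j j′J jJ) ,
    Avoid ,
    ((λ r Ar → proj₁ (⌊⌋-elim (lower Ar))) ,
     avoid-down i-min i⊑w , bounded i i⊑w , avoid-down i′-min i′⊑w , bounded i′ i′⊑w) ,
    ⋃ᶜ Avoid pw , ⋃ᶜ (Avoid ∪ singleton i) pw′ ,
    ⋃-isJoin Avoid pw , ⋃-isJoin (Avoid ∪ singleton i) pw′ ,
    separated
    where
      Avoid : Sub
      Avoid r = Lift ℓS ⌊ Irreducible r × r ⊑ w × ¬ e ∈ᶜ r ⌋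

      avoid-down : ∀ {n} → IsMinimalFor e n → n ⊑ w → DownClosedIrr (Avoid ∪ singleton n)
      avoid-down _ _ x y (inj₁ Ay) x-irr x⊑y =
        let (_ , y⊑w , e∉y) = ⌊⌋-elim (lower Ay)
        in inj₁ (lift (⌊⌋-intro (x-irr , ⊑-trans {x} {y} {w} x⊑y y⊑w , λ xe → e∉y (x⊑y e xe))))
      avoid-down {n} (_ , least) n⊑w x y (inj₂ (y⊑n , _)) x-irr x⊑y with em {P = e ∈ᶜ x}
      ... | yes xe  = inj₂ (x⊑n , least x x⊑n xe)
        where x⊑n = ⊑-trans {x} {y} {n} x⊑y y⊑n
      ... | no e∉x  = inj₁ (lift (⌊⌋-intro (x-irr , (λ z xz → n⊑w z (y⊑n z (x⊑y z xz))) , e∉x)))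

      bounded : ∀ n → n ⊑ w → Consistent (Avoid ∪ singleton n)
      bounded _ n⊑w = w , λ { x (inj₁ Ax) → proj₁ (proj₂ (⌊⌋-elim (lower Ax)))
                          ; x (inj₂ (x⊑n , _)) z xz → n⊑w z (x⊑n z xz) }

      pw : PairwiseConsistent Avoid
      pw = consistent⇒pairwise {X = Avoid} (w , λ x Ax → proj₁ (proj₂ (⌊⌋-elim (lower Ax))))

      pw′ : PairwiseConsistent (Avoid ∪ singleton i)
      pw′ = consistent⇒pairwise {X = Avoid ∪ singleton i} (bounded i i⊑w)

      separated : ¬ (⋃ᶜ Avoid pw ≈ ⋃ᶜ (Avoid ∪ singleton i) pw′)
      separated (_ , big⊑small) =
        let e∈big         = ⌊⌋-intro (i , inj₂ (Eq.refl {i}) , contains i-min)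
            (r , Ar , re) = ⌊⌋-elim (big⊑small e e∈big)
        in proj₂ (proj₂ (⌊⌋-elim (lower Ar))) re

  minimal⇒weakPrime : ∀ {e i} → IsMinimalFor e i → WeakPrime i
  minimal⇒weakPrime {e} {i} i-min = minimal⇒irreducible i-min , λ X (u , u-bound) j jJ i⊑j →
    let (x , Xx , xe)        = ∈join⇒∈member X (consistent⇒pairwise {X = X} (u , u-bound)) j jJ
                                 (i⊑j e (contains i-min))
        (i′ , i′-min , i′⊑x) = minimalBelow x xe
        j⊑u                  = proj₂ jJ u u-bound
    in i′ , minimal⇒irreducible i′-min ,
       minimal-↔ u i′-min i-min (⊑-trans {i′} {x} {u} i′⊑x (u-bound x Xx))
                                (⊑-trans {i} {j} {u} i⊑j j⊑u) ,
       x , Xx , i′⊑x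

  isWeakPrimeDomain : IsWeakPrimeDomain
  isWeakPrimeDomain =
    isDomain ,
    λ d → (λ _ → proj₂) , λ u ub e de → let (i , i-min , i⊑d) = minimalBelow d de in
            ub i (minimal⇒weakPrime i-min , i⊑d) e (contains i-min)

  -- If d ≼ d′, take the first event x missing from d in a securing sequence of some new event:
  -- d together with the sequence up to x is a configuration strictly above d, hence all of d′.
  ≼-newEvent-unique : ∀ d d′ → d ≼ d′ →
                      ∀ {y y′} → y ∈ᶜ d′ → ¬ y ∈ᶜ d → y′ ∈ᶜ d′ → ¬ y′ ∈ᶜ d → y ≡ y′
  ≼-newEvent-unique d d′ (d⊑d′ , nothing-between) yd′ y∉d y′d′ y′∉d with history d′ yd′
  ... | L , inD′ , s , y∈L with firstFailure (_∈ᶜ d) y∈L y∉d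
  ... | First._++_∷_ {A} {x} A⊆d x∉d B = trans (new≡x yd′ y∉d) (sym (new≡x y′d′ y′∉d))
    where
      A∷x⊆d′ : setOf (A ∷ʳ x) ⊆ proj₁ d′
      A∷x⊆d′ e e∈ = All.lookup inD′ (prefix⊆ A x B e e∈)
      x∈A∷x : x ∈ A ∷ʳ x
      x∈A∷x = ∈-++⁺ʳ A (here refl)
      z : Conf
      z = unionBelow d (setOf (A ∷ʳ x) , prefix-isConfig (proj₁ (proj₂ d′)) A x B inD′ s) d′
                     d⊑d′ A∷x⊆d′
      z⊑d′ : z ⊑ d′
      z⊑d′ e (inj₁ ed)  = d⊑d′ e ed
      z⊑d′ e (inj₂ e∈) = A∷x⊆d′ e e∈
      d′⊑z : d′ ⊑ z
      d′⊑z = decidable-stable em λ ¬d′⊑z →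
        nothing-between (z , ((λ _ → inj₁) , λ (_ , z⊑d) → x∉d (z⊑d x (inj₂ x∈A∷x))) ,
                             (z⊑d′ , λ (_ , d′⊑z) → ¬d′⊑z d′⊑z))
      new≡x : ∀ {e} → e ∈ᶜ d′ → ¬ e ∈ᶜ d → e ≡ x
      new≡x ed′ e∉d with d′⊑z _ ed′
      ... | inj₁ ed = ⊥-elim (e∉d ed)
      ... | inj₂ e∈ with ∈-++⁻ A e∈
      ... | inj₁ e∈A        = ⊥-elim (e∉d (All.lookup A⊆d e∈A))
      ... | inj₂ (here e≡x) = e≡x

module ConfigurationMap (em : ∀ {ℓ} → ExcludedMiddle ℓ) (ℰ₁ ℰ₂ : EventStructure)
                        (f : ES.Ev ℰ₁ → Maybe (ES.Ev ℰ₂)) (f-mor : IsESMorphism ℰ₁ ℰ₂ f) where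
  private
    module E₁ = ES ℰ₁
    module E₂ = ES ℰ₂
    module S₁ = Securing ℰ₁
    module S₂ = Securing ℰ₂
    module C₁ = ConfigurationDomain em ℰ₁
    module C₂ = ConfigurationDomain em ℰ₂
    module D₁ = DomainTheory (𝒟 ℰ₁)
    module D₂ = DomainTheory (𝒟 ℰ₂)
  open Classical em
  open C₁ using () renaming (_⊑_ to _⊑₁_)
  open C₂ using () renaming (_⊑_ to _⊑₂_)

  image-enables : ∀ {C pre x b} → E₁.ConsistentSet C → All C pre → S₁.Secured [] pre →
                  pre E₁.⊢ x → f x ≡ just b → mapMaybe f pre E₂.⊢ b
  image-enables {pre = pre} {x} {b} cons inC s pre⊢x fx
    with proj₂ (proj₂ (f-mor (S₁.setOf pre) (S₁.IsConfig-setOf cons inC s) x x b b fx fx))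
               (pre , S₁.All-setOf pre , pre⊢x)
  ... | Y , inImage , Y⊢b = E₂.⊢-mono (λ y∈ → let (e , e∈ , fe) = All.lookup inImage y∈ in
                                              ∈-mapMaybe⁺ f pre e∈ fe) Y⊢b

  mapMaybe-Secured : ∀ {C} → E₁.ConsistentSet C → ∀ pre L → All C pre → All C L →
                     S₁.Secured [] pre → S₁.Secured pre L →
                     S₂.Secured (mapMaybe f pre) (mapMaybe f L)
  mapMaybe-Secured cons pre []      _     _          _    _           = tt
  mapMaybe-Secured cons pre (x ∷ L) inPre (cx ∷ inL) sPre (pre⊢x , s)
    with mapMaybe-Secured cons (pre ∷ʳ x) L (All.++⁺ inPre (cx ∷ [])) inL
                          (S₁.Secured-∷ʳ [] sPre pre⊢x) s
  ... | ih rewrite mapMaybe-++ f pre [ x ] with f x in fx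
  ... | just b  = image-enables cons inPre sPre pre⊢x fx , ih
  ... | nothing = subst (λ p → S₂.Secured p (mapMaybe f L)) (++-identityʳ (mapMaybe f pre)) ih

  image-isConfig : PreservesConfigs ℰ₁ ℰ₂ f
  image-isConfig C C-conf@(cons , sec) = cons′ , sec′
    where
      cons′ : E₂.ConsistentSet (imageSet ℰ₁ ℰ₂ f C)
      cons′ a a′ (e , ce , fe) (e′ , ce′ , fe′) a#a′ =
        cons e e′ ce ce′ (proj₁ (f-mor C C-conf e e′ a a′ fe fe′) a#a′)
      sec′ : ∀ a → imageSet ℰ₁ ℰ₂ f C a → E₂.SecuredIn (imageSet ℰ₁ ℰ₂ f C) a
      sec′ a (e , ce , fe) with S₁.SecuredIn⇒History (sec e ce)
      ... | L , inC , s , e∈ =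
        S₂.History⇒SecuredIn
          (mapMaybe f L ,
           All.tabulate (λ a∈ → let (e′ , e′∈ , fe′) = ∈-mapMaybe⁻ f L a∈
                                in e′ , All.lookup inC e′∈ , fe′) ,
           mapMaybe-Secured cons [] L [] inC tt s ,
           ∈-mapMaybe⁺ f L e∈ fe)

  -- Equal images of distinct events are in conflict.
  image-injective : ∀ {C} → E₁.IsConfig C →
                    ∀ {y y′ a} → C y → C y′ → f y ≡ just a → f y′ ≡ just a → y ≡ y′
  image-injective {C} C-conf {y} {y′} cy cy′ fy fy′ = decidable-stable em λ y≢y′ →
    proj₁ C-conf y y′ cy cy′ (proj₁ (proj₂ (f-mor C C-conf y y′ _ _ fy fy′)) refl y≢y′)

  F : E₁.Conf → E₂.Conf
  F = 𝒟map ℰ₁ ℰ₂ f image-isConfig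

  F-mono : ∀ x y → x ⊑₁ y → F x ⊑₂ F y
  F-mono _ _ x⊑y _ (e , xe , fe) = e , x⊑y e xe , fe

  F-≼ : ∀ d d′ → d D₁.≼ d′ → F d D₂.≼ F d′
  F-≼ d d′ d≼d′@(d⊑d′ , _) =
    F-mono d d′ d⊑d′ , λ (z , (Fd⊑z , Fd≉z) , (z⊑Fd′ , z≉Fd′)) →
    let (a , az , a∉Fd)       = ¬⊆⇒∃ λ z⊑Fd → Fd≉z (Fd⊑z , z⊑Fd)
        (b , Fd′b , b∉z)      = ¬⊆⇒∃ λ Fd′⊑z → z≉Fd′ (z⊑Fd′ , Fd′⊑z)
        (ea , ea∈d′ , fea)    = z⊑Fd′ a az
        (eb , eb∈d′ , feb)    = Fd′b
        ea≡eb = C₁.≼-newEvent-unique d d′ d≼d′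
                  ea∈d′ (λ ea∈d → a∉Fd (ea , ea∈d , fea))
                  eb∈d′ (λ eb∈d → b∉z (Fd⊑z b (eb , eb∈d , feb)))
        a≡b   = just-injective (trans (sym fea) (trans (cong f ea≡eb) feb))
    in b∉z (subst (proj₁ z) a≡b az)

  F-join : ∀ (X : D₁.Sub) → D₁.Consistent X → ∀ j → D₁.IsJoin X j →
           D₂.IsJoin (imageSub (𝒟 ℰ₁) (𝒟 ℰ₂) F X) (F j)
  F-join X X-cons j jJ@(j-ub , _) =
    (λ y (x , Xx , y⊑Fx , _) a ya → F-mono x j (j-ub x Xx) a (y⊑Fx a ya)) ,
    λ u ub a (e , je , fe) →
      let pw            = C₁.consistent⇒pairwise {X = X} X-cons
          (x , Xx , xe) = C₁.∈join⇒∈member X pw j jJ je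
      in ub (F x) (x , Xx , (λ _ → id) , (λ _ → id)) a (e , xe , fe)

  F-meet : ∀ d d′ → (Σ E₁.Conf λ u → d ⊑₁ u × d′ ⊑₁ u) →
           ∀ m → D₁.IsMeet d d′ m → m D₁.≼ d → D₂.IsMeet (F d) (F d′) (F m)
  F-meet d d′ (u , d⊑u , d′⊑u) m ((m⊑d , m⊑d′) , greatest) m≼d =
    (F-mono m d m⊑d , F-mono m d′ m⊑d′) , λ l l⊑Fd l⊑Fd′ a la →
      let (y , yd , fy)     = l⊑Fd a la
          (y′ , y′d′ , fy′) = l⊑Fd′ a la
      in inMeet yd y′d′ fy fy′
    where
      -- A preimage y ∉ m is the only event of d ∖ m (as m ≼ d) and, f being injective on u,
      -- lies in d′; so d ⊑ d′ and hence d ⊑ m.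
      inMeet : ∀ {a y y′} → proj₁ d y → proj₁ d′ y′ → f y ≡ just a → f y′ ≡ just a →
               proj₁ (F m) a
      inMeet {y = y} yd y′d′ fy fy′ with em {P = proj₁ m y}
      ... | yes ym = y , ym , fy
      ... | no y∉m with image-injective (proj₂ u) (d⊑u _ yd) (d′⊑u _ y′d′) fy fy′
      ... | refl = ⊥-elim (y∉m (greatest d (λ _ → id) d⊑d′ y yd))
        where
          d⊑d′ : d ⊑₁ d′
          d⊑d′ z zd with em {P = proj₁ m z}
          ... | yes zm  = m⊑d′ z zm
          ... | no z∉m = subst (proj₁ d′) (C₁.≼-newEvent-unique m d m≼d yd y∉m zd z∉m) y′d′

  isWPDMorphism : IsWPDMorphism (𝒟 ℰ₁) (𝒟 ℰ₂) F
  isWPDMorphism =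
    (λ {x} {y} (x⊑y , y⊑x) → F-mono x y x⊑y , F-mono y x y⊑x) , F-≼ , F-join , F-meet

mainTheorem15 : (em : ∀ {ℓ} → ExcludedMiddle ℓ) →
    ((ℰ : EventStructure) → ES.Live ℰ → DomainTheory.IsWeakPrimeDomain (𝒟 ℰ))
    × ((ℰ₁ ℰ₂ : EventStructure) → ES.Live ℰ₁ → ES.Live ℰ₂ →
       (f : ES.Ev ℰ₁ → Maybe (ES.Ev ℰ₂)) → IsESMorphism ℰ₁ ℰ₂ f →
       Σ (PreservesConfigs ℰ₁ ℰ₂ f) λ p →
         IsWPDMorphism (𝒟 ℰ₁) (𝒟 ℰ₂) (𝒟map ℰ₁ ℰ₂ f p))
mainTheorem15 em =
  (λ ℰ _ → ConfigurationDomain.isWeakPrimeDomain em ℰ) ,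
  λ ℰ₁ ℰ₂ _ _ f f-mor → let open ConfigurationMap em ℰ₁ ℰ₂ f f-mor
                        in image-isConfig , isWPDMorphism
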